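{- Let $\mathcal{N}$ be a dynamic flow network with uniform edge capacity $u$ and single sink $s^-$ of in-degree $d$. For each $p\in\{1,\dots,d\}$ and $(v_1,\dots,v_p)\in(S^+)^p$, there exists a source subset $A\subseteq S^+$ that admits $(v_1,\dots,v_p)$ if and only if the set $\{v_1,\dots,v_p\}$ admits $(v_1,\dots,v_p)$.
   Context: A dynamic flow network $\mathcal{N}=(D=(V,E),u,\tau,S^+,\{s^-\})$ consists of a directed graph $D=(V,E)$, a capacity $u>0$ common to all edges, transit times $\tau:E\to\mathbb{R}_{>0}$, sources $S^+\subseteq V$ and a single sink $s^-\in V\setminus S^+$; $d$ is the number of edges entering $s^-$. Successive shortest paths: $\bar{\mathcal{N}}$ is the static network on $D$ with capacity $u$ and cost $\tau(e)$. For static flow $\bar f$, the residual network $\bar{\mathcal{N}}_{\bar f}$ has edge $(a,b)$ with capacity $u-\bar f(e)$, cost $\tau(e)$ for each $e=(a,b)$, and if $\bar f(e)>0$ the reverse edge $(b,a)$ with capacity $\bar f(e)$, cost $-\tau(e)$ (only positive-capacity edges present). For $A\subseteq S^+$, starting from $\bar f=0$, repeatedly take a minimum-cost path $P^A_i$ from a node of $A$ to $s^-$ in $\bar{\mathcal{N}}_{\bar f}$ (ties broken by a fixed rule so the output is unique), stop if none exists, otherwise augment $u$ units along it; $p^A$ is the number of paths found. For $p\in\{1,\dots,d\}$ and $(v_1,\dots,v_p)\in(S^+)^p$, $A$ admits $(v_1,\dots,v_p)$ if $p^A=p$ and the origin of $P^A_i$ is $v_i$ for each $i=1,\dots,p$.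 -}

module Defs where

open import Data.Nat using (ℕ)
open import Data.Fin using (Fin; _≟_)
open import Data.Fin.Subset using (Subset; _∈_; _∉_; ⁅_⁆; _∪_) renaming (⊥ to ∅)
open import Data.List using (List; []; _∷_; map; foldr; length; filter)
open import Data.List.Relation.Unary.All using (All)
open import Data.List.Relation.Unary.Unique.Propositional using (Unique)
open import Data.Vec using (Vec; toList) renaming ([] to []ᵥ; _∷_ to _∷ᵥ_)
open import Data.Product using (_×_; _,_; proj₁; ∃)
open import Data.Sum using (_⊎_)
open import Data.List using (allFin) public
open import Relation.Nullary using (¬_; yes; no)
open import Relation.Binary.PropositionalEquality using (_≡_; _≢_)
open import Relation.Binary.Structures using (IsTotalOrder; IsStrictTotalOrder)
open import Algebra.Structures using (IsAbelianGroup)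

record OrderedAbGroup : Set₁ where
  infixl 6 _+_
  infix 4 _≤_ _<_
  field
    Carrier : Set
    _+_ : Carrier → Carrier → Carrier
    0# : Carrier
    -_ : Carrier → Carrier
    _≤_ : Carrier → Carrier → Set
    isAbelianGroup : IsAbelianGroup _≡_ _+_ 0# -_
    isTotalOrder : IsTotalOrder _≡_ _≤_
    +-mono-≤ : ∀ {a b} c → a ≤ b → a + c ≤ b + c

  _<_ : Carrier → Carrier → Set
  a < b = a ≤ b × a ≢ b

record Network (G : OrderedAbGroup) : Set where
  open OrderedAbGroup G
  field
    n m : ℕ
    tl hd : Fin m → Fin n
    u : Carrier
    u-pos : 0# < u
    τ : Fin m → Carrier
    τ-pos : ∀ e → 0# < τ e
    S⁺ : Subset n
    s⁻ : Fin n
    s⁻∉S⁺ : s⁻ ∉ S⁺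

module Dyn {G : OrderedAbGroup} (N : Network G) where
  open OrderedAbGroup G
  open Network N

  indeg : ℕ
  indeg = length (filter (λ e → hd e ≟ s⁻) (allFin m))

  data Dir : Set where
    fwd bwd : Dir

  -- residual edges: forward copy / reverse copy of an edge of D
  REdge : Set
  REdge = Fin m × Dir

  rsrc rtgt : REdge → Fin n
  rsrc (e , fwd) = tl e
  rsrc (e , bwd) = hd e
  rtgt (e , fwd) = hd e
  rtgt (e , bwd) = tl e

  rcost : REdge → Carrier
  rcost (e , fwd) = τ e
  rcost (e , bwd) = - τ e

  Flow : Set
  Flow = Fin m → Carrier

  zeroFlow : Flow
  zeroFlow _ = 0#

  Present : Flow → REdge → Set
  Present f (e , fwd) = f e < u        -- capacity u - f(e) > 0
  Present f (e , bwd) = 0# < f e       -- capacity f(e) > 0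

  IsWalk : Fin n → List REdge → Fin n → Set
  IsWalk a [] b = a ≡ b
  IsWalk a (r ∷ rs) b = rsrc r ≡ a × IsWalk (rtgt r) rs b

  Path : Set
  Path = Fin n × List REdge

  origin : Path → Fin n
  origin = proj₁

  vertices : Path → List (Fin n)
  vertices (a , rs) = a ∷ map rtgt rs

  cost : Path → Carrier
  cost (a , rs) = foldr (λ r c → rcost r + c) 0# rs

  AugPath : Subset n → Flow → Path → Set
  AugPath A f P@(a , rs) =
    a ∈ A × IsWalk a rs s⁻ × All (Present f) rs × Unique (vertices P)

  MinCost : Subset n → Flow → Path → Set
  MinCost A f P = AugPath A f P × (∀ Q → AugPath A f Q → cost P ≤ cost Q)

  record TieBreak : Set₁ where
    field
      _≺_ : Flow → Path → Path → Set
      isSTO : ∀ f → IsStrictTotalOrder _≡_ (_≺_ f)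

  Chosen : TieBreak → Subset n → Flow → Path → Set
  Chosen T A f P = MinCost A f P × (∀ Q → MinCost A f Q → P ≡ Q ⊎ TieBreak._≺_ T f P Q)

  augment1 : REdge → Flow → Flow
  augment1 (e , fwd) f e' with e' ≟ e
  ... | yes _ = f e' + u
  ... | no _ = f e'
  augment1 (e , bwd) f e' with e' ≟ e
  ... | yes _ = f e' + (- u)
  ... | no _ = f e'

  augment : Flow → Path → Flow
  augment f (a , rs) = foldr augment1 f rs

  -- Run T A f ps : successive shortest paths from A, started at flow f,
  -- produces exactly the sequence of paths ps and then stops.
  data Run (T : TieBreak) (A : Subset n) : Flow → List Path → Set where
    stop : ∀ {f} → (∀ P → ¬ AugPath A f P) → Run T A f []
    step : ∀ {f P ps} → Chosen T A f P → Run T A (augment f P) ps → Run T A f (P ∷ ps)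

  -- A admits (v₁,…,v_p): p^A = p and P^A_i starts at v_i
  Admits : ∀ {p} → TieBreak → Subset n → Vec (Fin n) p → Set
  Admits T A vs = ∃ λ ps → Run T A zeroFlow ps × map origin ps ≡ toList vs

  setOf : ∀ {p} → Vec (Fin n) p → Subset n
  setOf []ᵥ = ∅
  setOf (v ∷ᵥ vs) = ⁅ v ⁆ ∪ setOf vs

{-# OPTIONS --safe #-}
module Submission where

open import Defs
open import Data.Nat using (ℕ; _≤_)
open import Data.Fin using (Fin)
open import Data.Fin.Subset using (Subset; _∈_; _⊆_)
open import Data.Fin.Subset.Properties using (∉⊥; x∈⁅x⁆; x∈⁅y⁆⇒x≡y; p⊆p∪q; q⊆p∪q; x∈p∪q⁻)
open import Data.Empty using (⊥-elim)
open import Data.Vec using (Vec) renaming ([] to []ᵥ; _∷_ to _∷ᵥ_)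
open import Data.Vec.Relation.Unary.All as VAll using (All) renaming ([] to []ᵃ; _∷_ to _∷ᵃ_)
open import Data.Vec.Relation.Unary.All.Properties using (toList⁺; toList⁻)
import Data.List.Relation.Unary.All as LAll
open import Data.List.Relation.Unary.All.Properties using (map⁺; map⁻)
open import Data.Product using (_×_; ∃; _,_; proj₁)
open import Data.Sum using (inj₁; inj₂)
open import Function using (_∘_)
open import Function.Bundles using (_⇔_; mk⇔)
open import Relation.Binary.PropositionalEquality using (subst; sym)
open import Relation.Binary.Structures using (IsTotalOrder)

-- Shrinking the source set only removes candidate paths, so as long as every
-- path chosen from A still starts in B ⊆ A, it remains the chosen (minimum-cost,
-- tie-break-first) path from B, and "no path left" from A implies the same
-- from B. Since the origins of a run from A lie in A, the set {v₁,…,v_p} is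
-- squeezed between the origins and A, so A may be replaced by it.

module SourceRestriction {G : OrderedAbGroup} (N : Network G) (T : Dyn.TieBreak N) where
  open OrderedAbGroup G using (isTotalOrder)
  open Network N
  open Dyn N

  setOf-⊆ : ∀ {p S} (vs : Vec (Fin n) p) → All (_∈ S) vs → setOf vs ⊆ S
  setOf-⊆ []ᵥ []ᵃ x∈∅ = ⊥-elim (∉⊥ x∈∅)
  setOf-⊆ (v ∷ᵥ vs) (v∈S ∷ᵃ vs⊆S) x∈ with x∈p∪q⁻ _ _ x∈
  ... | inj₁ x∈⁅v⁆ = subst (_∈ _) (sym (x∈⁅y⁆⇒x≡y v x∈⁅v⁆)) v∈S
  ... | inj₂ x∈vs = setOf-⊆ vs vs⊆S x∈vs

  ∈-setOf : ∀ {p} (vs : Vec (Fin n) p) → All (_∈ setOf vs) vs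
  ∈-setOf []ᵥ = []ᵃ
  ∈-setOf (v ∷ᵥ vs) = p⊆p∪q _ (x∈⁅x⁆ v) ∷ᵃ VAll.map (q⊆p∪q _ _) (∈-setOf vs)

  AugPath-mono : ∀ {A B f} → B ⊆ A → ∀ P → AugPath B f P → AugPath A f P
  AugPath-mono B⊆A P (o∈B , rest) = B⊆A o∈B , rest

  Chosen-restrict : ∀ {A B f P} → B ⊆ A → origin P ∈ B → Chosen T A f P → Chosen T B f P
  Chosen-restrict {B = B} {f} {P} B⊆A o∈B (((_ , path) , minA) , firstA) =
    (augB , λ Q → minA Q ∘ AugPath-mono B⊆A Q) ,
    λ Q (augQ , minQ) → firstA Q (AugPath-mono B⊆A Q augQ ,
                                  λ Q′ augQ′ → trans (minQ P augB) (minA Q′ augQ′))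
    where
    open IsTotalOrder isTotalOrder using (trans)
    augB : AugPath B f P
    augB = o∈B , path

  Run-restrict : ∀ {A B f ps} → B ⊆ A → LAll.All (λ P → origin P ∈ B) ps →
                 Run T A f ps → Run T B f ps
  Run-restrict B⊆A LAll.[] (stop none) = stop λ P → none P ∘ AugPath-mono B⊆A P
  Run-restrict B⊆A (o∈B LAll.∷ os∈B) (step chosen run) =
    step (Chosen-restrict B⊆A o∈B chosen) (Run-restrict B⊆A os∈B run)

  Run-origins∈ : ∀ {A f ps} → Run T A f ps → LAll.All (λ P → origin P ∈ A) ps
  Run-origins∈ (stop _) = LAll.[]
  Run-origins∈ (step chosen run) = proj₁ (proj₁ (proj₁ chosen)) LAll.∷ Run-origins∈ run

  Admits-origins∈ : ∀ {p A} {vs : Vec (Fin n) p} → Admits T A vs → All (_∈ A) vs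
  Admits-origins∈ (ps , run , origins≡vs) =
    toList⁻ (subst (LAll.All _) origins≡vs (map⁺ (Run-origins∈ run)))

  Admits-restrict : ∀ {p A B} {vs : Vec (Fin n) p} → B ⊆ A → All (_∈ B) vs →
                    Admits T A vs → Admits T B vs
  Admits-restrict B⊆A vs∈B (ps , run , origins≡vs) =
    ps , Run-restrict B⊆A (map⁻ (subst (LAll.All _) (sym origins≡vs) (toList⁺ vs∈B))) run ,
    origins≡vs

lemma5 : (G : OrderedAbGroup) (N : Network G) (T : Dyn.TieBreak N)
         (p : ℕ) → 1 ≤ p → p ≤ Dyn.indeg N →
         (vs : Vec (Fin (Network.n N)) p) → All (_∈ Network.S⁺ N) vs →
         (∃ λ A → A ⊆ Network.S⁺ N × Dyn.Admits N T A vs)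
           ⇔ Dyn.Admits N T (Dyn.setOf N vs) vs
lemma5 G N T p _ _ vs vs∈S⁺ = mk⇔ restrict (λ admits → Dyn.setOf N vs , setOf-⊆ vs vs∈S⁺ , admits)
  where
  open SourceRestriction N T
  restrict : (∃ λ A → A ⊆ Network.S⁺ N × Dyn.Admits N T A vs) → Dyn.Admits N T (Dyn.setOf N vs) vs
  restrict (A , _ , admits) = Admits-restrict (setOf-⊆ vs (Admits-origins∈ admits)) (∈-setOf vs) admits
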